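{- For every integer $n\ge 2$, let $H^*_n$ be the graph with vertex set $\{w,x_1,\dots,x_n,v,y,z,u,u'\}$ whose edges are: the path edges $wx_1,\ x_1x_2,\ \dots,\ x_{n-1}x_n,\ x_nv$; the edges $yw$ and $yx_i$ for $i=1,\dots,n$; the edges $zv$ and $zx_i$ for $i=1,\dots,n$; the edges $yz,\ uy,\ uz$; and the edge $uu'$. Then $H^*_n$ is a forbidden induced subgraph for co-TT graphs, i.e. $H^*_n$ is not a co-TT graph.
   Context: A graph $G=(V,E)$ is a threshold tolerance graph if each vertex $v$ can be assigned a positive weight $w_v$ and a positive tolerance $t_v$ such that for distinct $u,v$, $uv\in E$ iff $w_u+w_v>\min\{t_u,t_v\}$. A co-TT graph is the complement of a threshold tolerance graph. Equivalently (Monma–Reed–Trotter), $G$ is co-TT iff one can assign positive numbers $a_v,b_v$ to each vertex $v$ such that for distinct $x,y$: $xy\in E$ iff $a_x\le b_y$ and $a_y\le b_x$. The class of co-TT graphs is closed under taking induced subgraphs.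
   Formalization: The positive weights $w_v$ and tolerances $t_v$ of threshold tolerance graphs take values in the rationals. -}

module Defs where

open import Data.Nat using (ℕ; suc)
open import Data.Fin using (Fin; toℕ)
open import Data.Rational using (ℚ; 0ℚ; _+_; _⊓_; _<_)
open import Data.Product using (Σ; _×_)
open import Data.Sum using (_⊎_)
open import Relation.Nullary using (¬_)
open import Relation.Binary.PropositionalEquality using (_≡_; _≢_)
open import Function.Bundles using (_⇔_)

record Graph : Set₁ where
  field
    Vertex : Set
    Adj    : Vertex → Vertex → Set

open Graph public

IsTT : Graph → Set
IsTT G = Σ (Vertex G → ℚ) λ w → Σ (Vertex G → ℚ) λ t →
  ((p : Vertex G) → (0ℚ < w p) × (0ℚ < t p)) ×
  ((p q : Vertex G) → p ≢ q → (Adj G p q ⇔ (t p ⊓ t q < w p + w q)))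

complement : Graph → Graph
complement G = record
  { Vertex = Vertex G
  ; Adj    = λ p q → (p ≢ q) × ¬ Adj G p q }

IsCoTT : Graph → Set
IsCoTT G = IsTT (complement G)

-- Vertices of H*_n : w, x_1..x_n (x i for i : Fin n, x_{i+1} = x i), v, y, z, u, u'.
data HV (n : ℕ) : Set where
  w : HV n
  x : Fin n → HV n
  v y z u u′ : HV n

data HE (n : ℕ) : HV n → HV n → Set where
  w-x₁  : (i : Fin n) → toℕ i ≡ 0 → HE n w (x i)
  x-x   : (i j : Fin n) → toℕ j ≡ suc (toℕ i) → HE n (x i) (x j)
  xₙ-v  : (i : Fin n) → suc (toℕ i) ≡ n → HE n (x i) v
  y-w   : HE n y w
  y-x   : (i : Fin n) → HE n y (x i)
  z-v   : HE n z v
  z-x   : (i : Fin n) → HE n z (x i)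
  y-z   : HE n y z
  u-y   : HE n u y
  u-z   : HE n u z
  u-u′  : HE n u u′

H* : ℕ → Graph
H* n = record
  { Vertex = HV n
  ; Adj    = λ p q → HE n p q ⊎ HE n q p }

{-# OPTIONS --safe #-}
-- Take a threshold tolerance representation (w, t) of the complement, put a p = w p and
-- b p = t p − w p (Monma–Reed–Trotter), and let p ≺ q mean b p < a q.  Two distinct vertices are
-- then adjacent exactly when neither precedes the other, and ≺ is a Ferrers relation:
-- r ≺ s, a s ≤ b p and p ≺ q give r ≺ q.
-- Since u has the non-adjacent neighbours u′ and y, a u ≤ b u, so every non-neighbour of u lies
-- before or after u, and this side cannot change along an edge between non-neighbours of u.
-- Hence the path w x₁ … xₙ lies, say, before u.  As y and z are neighbours of u, the non-edges
-- yv and zw force v ≺ y and w ≺ z, and the Ferrers property through the edge yw gives v ≺ z,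
-- contradicting the edge zv.  "After u" is the same argument for the reversed relation.
module Submission where

open import Defs
open import Data.Nat using (ℕ; _≤_; suc; s≤s)
open import Data.Nat.Properties using (1+n≢n)
open import Data.Fin using (zero; suc; inject₁; fromℕ)
open import Data.Fin.Properties using (toℕ-inject₁; toℕ-fromℕ)
open import Data.Fin.Induction using (<-weakInduction)
open import Data.Rational using (ℚ; _+_; _-_; -_; _⊓_; _<_)
open import Data.Rational.Properties
  using (+-comm; +-monoˡ-<; ≤-<-trans; <-≤-trans; <-trans; ≮⇒≥; p⊓q≤p; p⊓q≤q; ⊓-sel; +-0-abelianGroup)
open import Algebra.Properties.AbelianGroup +-0-abelianGroup using (xyx⁻¹≈y; //-rightDividesˡ)
open import Data.Product using (_×_; _,_; proj₁; proj₂) renaming (swap to ×-swap)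
open import Data.Sum using (_⊎_; inj₁; inj₂; [_,_]) renaming (swap to ⊎-swap)
open import Relation.Nullary using (¬_; contradiction)
open import Relation.Binary.PropositionalEquality using (_≢_; refl; sym; cong; subst; subst₂)
open import Function using (flip)
open import Function.Bundles using (_⇔_; mk⇔; Equivalence)
open import Function.Construct.Composition using (_⇔-∘_)

p<q+r⇒p-q<r : ∀ {p q r : ℚ} → p < q + r → p - q < r
p<q+r⇒p-q<r {p} {q} {r} h = subst (p - q <_) (xyx⁻¹≈y q r) (+-monoˡ-< (- q) h)

p-q<r⇒p<q+r : ∀ {p q r : ℚ} → p - q < r → p < q + r
p-q<r⇒p<q+r {p} {q} {r} h = subst₂ _<_ (//-rightDividesˡ q p) (+-comm r q) (+-monoˡ-< q h)

p⊓q<r+s⇔p-r<s⊎q-s<r : ∀ (p q r s : ℚ) → (p ⊓ q < r + s) ⇔ (p - r < s ⊎ q - s < r)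
p⊓q<r+s⇔p-r<s⊎q-s<r p q r s = mk⇔ to from
  where
  to : p ⊓ q < r + s → p - r < s ⊎ q - s < r
  to h with ⊓-sel p q
  ... | inj₁ p⊓q≡p = inj₁ (p<q+r⇒p-q<r (subst (_< r + s) p⊓q≡p h))
  ... | inj₂ p⊓q≡q = inj₂ (p<q+r⇒p-q<r (subst₂ _<_ p⊓q≡q (+-comm r s) h))
  from : p - r < s ⊎ q - s < r → p ⊓ q < r + s
  from (inj₁ h) = ≤-<-trans (p⊓q≤p p q) (p-q<r⇒p<q+r h)
  from (inj₂ h) = ≤-<-trans (p⊓q≤q p q) (subst (q <_) (+-comm s r) (p-q<r⇒p<q+r h))

record CoTTOrder (G : Graph) : Set₁ where
  field
    _≺_                    : Vertex G → Vertex G → Set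
    ≺-ferrers              : ∀ {p q r s} → r ≺ s → ¬ p ≺ s → p ≺ q → r ≺ q
    adjacent⇒incomparable  : ∀ {p q} → p ≢ q → Adj G p q → ¬ p ≺ q × ¬ q ≺ p
    nonadjacent⇒comparable : ∀ {p q} → p ≢ q → ¬ Adj G p q → p ≺ q ⊎ q ≺ p

dual : ∀ {G} → CoTTOrder G → CoTTOrder G
dual O = record
  { _≺_                    = flip _≺_
  ; ≺-ferrers              = λ r≻s p⊀s p≻q → ≺-ferrers p≻q p⊀s r≻s
  ; adjacent⇒incomparable  = λ p≢q pq → ×-swap (adjacent⇒incomparable p≢q pq)
  ; nonadjacent⇒comparable = λ p≢q ¬pq → ⊎-swap (nonadjacent⇒comparable p≢q ¬pq)
  }
  where open CoTTOrder O

coTT⇒order : ∀ {G} → IsCoTT G → CoTTOrder G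
coTT⇒order {G} (weight , tolerance , _ , tt) = record
  { _≺_                    = _≺_
  ; ≺-ferrers              = λ r≺s p⊀s p≺q → <-trans (<-≤-trans r≺s (≮⇒≥ p⊀s)) p≺q
  ; adjacent⇒incomparable  = λ p≢q pq →
      (λ p≺q → proj₂ (from p≢q (inj₁ p≺q)) pq) , (λ q≺p → proj₂ (from p≢q (inj₂ q≺p)) pq)
  ; nonadjacent⇒comparable = λ p≢q ¬pq → to p≢q (p≢q , ¬pq)
  }
  where
  _≺_ : Vertex G → Vertex G → Set
  p ≺ q = tolerance p - weight p < weight q

  nonadjacent⇔comparable : ∀ {p q} → p ≢ q → (p ≢ q × ¬ Adj G p q) ⇔ (p ≺ q ⊎ q ≺ p)
  nonadjacent⇔comparable {p} {q} p≢q =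
    p⊓q<r+s⇔p-r<s⊎q-s<r (tolerance p) (tolerance q) (weight p) (weight q) ⇔-∘ tt p q p≢q

  to : ∀ {p q} → p ≢ q → p ≢ q × ¬ Adj G p q → p ≺ q ⊎ q ≺ p
  to p≢q = Equivalence.to (nonadjacent⇔comparable p≢q)

  from : ∀ {p q} → p ≢ q → p ≺ q ⊎ q ≺ p → p ≢ q × ¬ Adj G p q
  from p≢q = Equivalence.from (nonadjacent⇔comparable p≢q)

module _ {G : Graph} (O : CoTTOrder G) where
  open CoTTOrder O

  independent-neighbours⇒⊀-self : ∀ {u p q} → u ≢ p → u ≢ q → p ≢ q →
                                  Adj G u p → Adj G u q → ¬ Adj G p q → ¬ u ≺ u
  independent-neighbours⇒⊀-self u≢p u≢q p≢q up uq ¬pq u≺u with nonadjacent⇒comparable p≢q ¬pq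
  ... | inj₁ p≺q = proj₁ (adjacent⇒incomparable u≢q uq)
                          (≺-ferrers u≺u (proj₂ (adjacent⇒incomparable u≢p up)) p≺q)
  ... | inj₂ q≺p = proj₁ (adjacent⇒incomparable u≢p up)
                          (≺-ferrers u≺u (proj₂ (adjacent⇒incomparable u≢q uq)) q≺p)

  ≺-propagates-along-edge : ∀ {u p q} → ¬ u ≺ u → p ≺ u → p ≢ q → Adj G p q →
                            q ≢ u → ¬ Adj G q u → q ≺ u
  ≺-propagates-along-edge ¬u≺u p≺u p≢q pq q≢u ¬qu with nonadjacent⇒comparable q≢u ¬qu
  ... | inj₁ q≺u = q≺u
  ... | inj₂ u≺q = contradiction (≺-ferrers p≺u ¬u≺u u≺q) (proj₁ (adjacent⇒incomparable p≢q pq))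

edge⇒distinct : ∀ {n} {p q : HV n} → HE n p q → p ≢ q
edge⇒distinct e refl = no-loop e
  where
  no-loop : ∀ {n} {p : HV n} → ¬ HE n p p
  no-loop (x-x i .i i≡1+i) = 1+n≢n (sym i≡1+i)

path-before-u-impossible : ∀ {m} (O : CoTTOrder (H* (suc m))) → let open CoTTOrder O in
                           ¬ u ≺ u → ¬ w ≺ u
path-before-u-impossible {m} O ¬u≺u w≺u =
  contradiction (≺-ferrers v≺y (edge⇒⊁ y-w) w≺z) (edge⇒⊁ z-v)
  where
  open CoTTOrder O

  edge⇒⊀ : ∀ {p q} → HE (suc m) p q → ¬ p ≺ q
  edge⇒⊀ e = proj₁ (adjacent⇒incomparable (edge⇒distinct e) (inj₁ e))

  edge⇒⊁ : ∀ {p q} → HE (suc m) p q → ¬ q ≺ p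
  edge⇒⊁ e = proj₂ (adjacent⇒incomparable (edge⇒distinct e) (inj₁ e))

  ≺u-along-edge : ∀ {p} i → HE (suc m) p (x i) → p ≺ u → x i ≺ u
  ≺u-along-edge i e p≺u =
    ≺-propagates-along-edge O ¬u≺u p≺u (edge⇒distinct e) (inj₁ e) (λ ()) (λ { (inj₁ ()) ; (inj₂ ()) })

  x≺u : ∀ i → x i ≺ u
  x≺u = <-weakInduction (λ i → x i ≺ u) (≺u-along-edge zero (w-x₁ zero refl) w≺u)
          (λ i → ≺u-along-edge (suc i) (x-x (inject₁ i) (suc i) (cong suc (sym (toℕ-inject₁ i)))))

  v≺y : v ≺ y
  v≺y with nonadjacent⇒comparable (λ ()) (λ { (inj₁ ()) ; (inj₂ ()) })
  ... | inj₁ v≺y = v≺y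
  ... | inj₂ y≺v = contradiction (≺-ferrers y≺v (edge⇒⊀ xₙ-v′) (x≺u (fromℕ m))) (edge⇒⊁ u-y)
    where xₙ-v′ = xₙ-v (fromℕ m) (cong suc (toℕ-fromℕ m))

  w≺z : w ≺ z
  w≺z with nonadjacent⇒comparable (λ ()) (λ { (inj₁ ()) ; (inj₂ ()) })
  ... | inj₁ w≺z = w≺z
  ... | inj₂ z≺w = contradiction (≺-ferrers z≺w (edge⇒⊁ (w-x₁ zero refl)) (x≺u zero)) (edge⇒⊁ u-z)

H*-not-coTT : ∀ m → ¬ IsCoTT (H* (suc m))
H*-not-coTT m coTT =
  [ path-before-u-impossible O ¬u≺u , path-before-u-impossible (dual O) ¬u≺u ]
    (nonadjacent⇒comparable {w} {u} (λ ()) (λ { (inj₁ ()) ; (inj₂ ()) }))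
  where
  O : CoTTOrder (H* (suc m))
  O = coTT⇒order coTT
  open CoTTOrder O

  ¬u≺u : ¬ u ≺ u
  ¬u≺u = independent-neighbours⇒⊀-self O {u} {u′} {y} (λ ()) (λ ()) (λ ())
           (inj₁ u-u′) (inj₁ u-y) (λ { (inj₁ ()) ; (inj₂ ()) })

lemma18 : (n : ℕ) → 2 ≤ n → ¬ IsCoTT (H* n)
lemma18 (suc m) (s≤s _) = H*-not-coTT m
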